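{- For every integer $k\ge4$ there exists a $k$-star $\Gamma$ with vertex set $V=\mathbb{Z}\times\{0,1\}$ such that $\mathrm{Orb}_{\mathbb{Z}}(\Gamma)=\{\Gamma+d: d\in\mathbb{Z}\}$ is a factorization of the complete graph $K_V$ into $k$-stars, i.e. the graphs $\Gamma+d$, $d\in\mathbb{Z}$, are spanning subgraphs of $K_V$ whose edge sets partition $E(K_V)$.
   Context: The countable star $S_1$ is the graph with vertex set $\mathbb{N}$ and edges $\{0,i\}$, $i\ge1$; a $k$-star is a graph isomorphic to the vertex-disjoint union of $k$ copies of $S_1$. For a graph $\Gamma$ with vertices in $\mathbb{Z}\times\{0,1,\dots,h\}$ and $d\in\mathbb{Z}$, $\Gamma+d$ is the graph obtained by replacing each vertex $(x,i)$ with $(x+d,i)$. $K_V$ is the complete graph on $V$. -}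

module Defs where

open import Data.Nat using (ℕ)
open import Data.Integer using (ℤ; _+_; -_)
open import Data.Fin using (Fin)
open import Data.Product using (Σ; _×_; _,_)
open import Data.Sum using (_⊎_)
open import Relation.Binary.PropositionalEquality using (_≡_; _≢_)
open import Function.Bundles using (Bijection; _⤖_; _⇔_)

-- Simplicity (symmetry, irreflexivity) is not imposed here; for the graphs in
-- the theorem it follows from being isomorphic to a k-star.
Graph : Set → Set₁
Graph A = A → A → Set

V : Set
V = ℤ × Fin 2

-- The k-star: disjoint union of k copies of the countable star S₁,
-- on vertex set Fin k × ℕ; copy j has edges {(j,0),(j,i)} for i ≥ 1.
StarEdge : ℕ → ℕ → Set
StarEdge m n = (m ≡ 0 × n ≢ 0) ⊎ (n ≡ 0 × m ≢ 0)

KStarGraph : (k : ℕ) → Graph (Fin k × ℕ)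
KStarGraph k (j , m) (j′ , n) = (j ≡ j′) × StarEdge m n

IsKStar : (k : ℕ) → Graph V → Set
IsKStar k Γ =
  Σ (V ⤖ (Fin k × ℕ)) λ f →
    ∀ u v → Γ u v ⇔ KStarGraph k (Bijection.to f u) (Bijection.to f v)

shiftV : ℤ → V → V
shiftV d (x , i) = (x + d , i)

_+G_ : Graph V → ℤ → Graph V
(Γ +G d) u v = Γ (shiftV (- d) u) (shiftV (- d) v)

KEdge : V → V → Set
KEdge u v = u ≢ v

-- Translating an edge keeps its levels and, for a pure edge, its length, for a mixed edge the
-- signed difference of its ends; these data classify the translation orbits of edges of K_V.
-- So if the vertices of a k-star Γ are enumerated as centres (j, 0) and leaves (j, n + 1), the
-- graphs Γ + d partition E(K_V) as soon as the spokes {(j, 0), (j, n + 1)} meet every orbit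
-- exactly once.  For k = 4 such a star is written down explicitly.  If in addition the vertices
-- v₀, v₁, … of star 0 satisfy v_{n+2} = v_n + δ, star 0 splits into the star with centre v₀ and
-- leaves v₁, v₃, v₅, … and the star with centre v₂ and leaves v₄, v₆, …: the spoke v₂v_{2n+4} is
-- the translate by δ of v₀v_{2n+2}, so every orbit is still met once, and the second star is
-- again periodic (with period 2δ).  Induction on k gives every k ≥ 4.
module Submission where

open import Defs
open import Data.Nat using (ℕ; _≤_)
open import Data.Integer using (ℤ)
open import Data.Product using (Σ; _×_; ∃!)
open import Relation.Binary.PropositionalEquality using (_≡_)

open import Data.Empty using (⊥-elim)
open import Data.Fin using (Fin; zero; suc; #_; opposite)
open import Data.Integer using (+_; -[1+_]; _+_; _-_; -_; _*_; ∣_∣)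
import Data.Integer.Properties as ℤ
open import Algebra.Properties.AbelianGroup ℤ.+-0-abelianGroup using (∙-cancelˡ; ⁻¹-anti-homo‿-)
open import Data.Integer.Tactic.RingSolver using (solve-∀)
open import Data.Nat using (zero; suc; _∸_; z≤n; s≤s)
import Data.Nat as ℕ
import Data.Nat.Properties as ℕₚ
open import Data.Product using (_,_; proj₁; proj₂; ∃; ∃₂; uncurry; swap)
open import Data.Sum using (_⊎_; inj₁; inj₂; [_,_]′; map; map₂)
open import Data.Sum.Properties using (inj₁-injective; inj₂-injective)
open import Function using (_∘_; id)
open import Function.Bundles using (Inverse; Injection; _↔_; mk↔ₛ′; mk⇔)
open import Function.Construct.Composition using (_↔-∘_)
open import Function.Properties.Inverse using (↔-sym; ↔⇒⤖; ↔⇒↣)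
open import Relation.Binary.PropositionalEquality
  using (_≢_; refl; sym; trans; cong; cong₂; subst; subst₂; module ≡-Reasoning)
open import Relation.Nullary using (¬_)

open ≡-Reasoning

-- Translation orbits of edges

SameEdge : {A : Set} → A → A → A → A → Set
SameEdge a b a′ b′ = (a ≡ a′ × b ≡ b′) ⊎ (a ≡ b′ × b ≡ a′)

SameEdge-map : {A B : Set} (f : A → B) {a b a′ b′ : A} →
               SameEdge a b a′ b′ → SameEdge (f a) (f b) (f a′) (f b′)
SameEdge-map f (inj₁ (p , q)) = inj₁ (cong f p , cong f q)
SameEdge-map f (inj₂ (p , q)) = inj₂ (cong f p , cong f q)

shiftV-∘ : ∀ a b u → shiftV a (shiftV b u) ≡ shiftV (b + a) u
shiftV-∘ a b (x , i) = cong (_, i) (ℤ.+-assoc x b a)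

shiftV-cancel : ∀ {d e} u → shiftV d u ≡ shiftV e u → d ≡ e
shiftV-cancel (x , _) eq = ∙-cancelˡ x _ _ (cong proj₁ eq)

shiftV-swap-cancel : ∀ {d e} u v → shiftV d u ≡ shiftV e v → shiftV d v ≡ shiftV e u → d ≡ e
shiftV-swap-cancel {d} {e} (x , _) (y , _) p q =
  ℤ.*-cancelˡ-≡ (+ 2) d e (∙-cancelˡ (x + y) _ _ (begin
    (x + y) + + 2 * d   ≡⟨ twice x y d ⟨
    (x + d) + (y + d)   ≡⟨ cong₂ _+_ (cong proj₁ p) (cong proj₁ q) ⟩
    (y + e) + (x + e)   ≡⟨ twice y x e ⟩
    (y + x) + + 2 * e   ≡⟨ cong (_+ + 2 * e) (ℤ.+-comm y x) ⟩
    (x + y) + + 2 * e   ∎))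
  where
  twice : ∀ a b c → (a + c) + (b + c) ≡ (a + b) + + 2 * c
  twice = solve-∀

Translate : V → V → V → V → Set
Translate u v u′ v′ = ∃ λ d → SameEdge (shiftV d u) (shiftV d v) u′ v′

translation-unique : ∀ {d e u v a b} →
  SameEdge (shiftV d u) (shiftV d v) a b → SameEdge (shiftV e u) (shiftV e v) a b → d ≡ e
translation-unique {u = u} (inj₁ (p , _)) (inj₁ (p′ , _)) = shiftV-cancel u (trans p (sym p′))
translation-unique {u = u} {v} (inj₁ (p , q)) (inj₂ (p′ , q′)) =
  shiftV-swap-cancel u v (trans p (sym q′)) (trans q (sym p′))
translation-unique {u = u} {v} (inj₂ (p , q)) (inj₁ (p′ , q′)) =
  shiftV-swap-cancel u v (trans p (sym q′)) (trans q (sym p′))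
translation-unique {v = v} (inj₂ (_ , q)) (inj₂ (_ , q′)) = shiftV-cancel v (trans q (sym q′))

-- A pure edge of length l ≥ 1 on level i lies in the orbit inj₁ (i , l − 1); a mixed edge lies in
-- the orbit inj₂ (y − x), where y is its end on level 1 and x its end on level 0.
Orbit : Set
Orbit = (Fin 2 × ℕ) ⊎ ℤ

orbit : V → V → Orbit
orbit (x , zero)     (y , zero)     = inj₁ (zero , ∣ y - x ∣ ∸ 1)
orbit (x , suc zero) (y , suc zero) = inj₁ (suc zero , ∣ y - x ∣ ∸ 1)
orbit (x , zero)     (y , suc zero) = inj₂ (y - x)
orbit (x , suc zero) (y , zero)     = inj₂ (x - y)

[i+k]-[j+k]≡i-j : ∀ i j k → (i + k) - (j + k) ≡ i - j
[i+k]-[j+k]≡i-j = solve-∀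

orbit-shift : ∀ d u v → orbit (shiftV d u) (shiftV d v) ≡ orbit u v
orbit-shift d (x , zero)     (y , zero)     = cong (λ z → inj₁ (zero , ∣ z ∣ ∸ 1)) ([i+k]-[j+k]≡i-j y x d)
orbit-shift d (x , suc zero) (y , suc zero) = cong (λ z → inj₁ (suc zero , ∣ z ∣ ∸ 1)) ([i+k]-[j+k]≡i-j y x d)
orbit-shift d (x , zero)     (y , suc zero) = cong inj₂ ([i+k]-[j+k]≡i-j y x d)
orbit-shift d (x , suc zero) (y , zero)     = cong inj₂ ([i+k]-[j+k]≡i-j x y d)

orbit-sym : ∀ u v → orbit u v ≡ orbit v u
orbit-sym (x , zero)     (y , zero)     = cong (λ z → inj₁ (zero , z ∸ 1)) (ℤ.∣i-j∣≡∣j-i∣ y x)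
orbit-sym (x , suc zero) (y , suc zero) = cong (λ z → inj₁ (suc zero , z ∸ 1)) (ℤ.∣i-j∣≡∣j-i∣ y x)
orbit-sym (x , zero)     (y , suc zero) = refl
orbit-sym (x , suc zero) (y , zero)     = refl

orbit-SameEdge : ∀ {a b a′ b′} → SameEdge a b a′ b′ → orbit a b ≡ orbit a′ b′
orbit-SameEdge (inj₁ (refl , refl)) = refl
orbit-SameEdge (inj₂ (refl , refl)) = orbit-sym _ _

∣i∣∸1≡∣j∣∸1⇒i≡±j : ∀ {i j} → i ≢ + 0 → j ≢ + 0 → ∣ i ∣ ∸ 1 ≡ ∣ j ∣ ∸ 1 → i ≡ j ⊎ i ≡ - j
∣i∣∸1≡∣j∣∸1⇒i≡±j {+ zero}     i≢0 _   _ = ⊥-elim (i≢0 refl)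
∣i∣∸1≡∣j∣∸1⇒i≡±j {j = + zero} _   j≢0 _ = ⊥-elim (j≢0 refl)
∣i∣∸1≡∣j∣∸1⇒i≡±j {+ suc _}  {+ suc _}  _ _ eq = inj₁ (cong (+_ ∘ suc) eq)
∣i∣∸1≡∣j∣∸1⇒i≡±j {+ suc _}  { -[1+ _ ]} _ _ eq = inj₂ (cong (+_ ∘ suc) eq)
∣i∣∸1≡∣j∣∸1⇒i≡±j { -[1+ _ ]} {+ suc _}  _ _ eq = inj₂ (cong -[1+_] eq)
∣i∣∸1≡∣j∣∸1⇒i≡±j { -[1+ _ ]} { -[1+ _ ]} _ _ eq = inj₁ (cong -[1+_] eq)

i+[j-i]≡j : ∀ i j → i + (j - i) ≡ j
i+[j-i]≡j = solve-∀

i+[j-k]≡j+[i-k] : ∀ i j k → i + (j - k) ≡ j + (i - k)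
i+[j-k]≡j+[i-k] = solve-∀

translate-by-difference : ∀ x y x′ y′ {i j} → y - x ≡ y′ - x′ →
  shiftV (x′ - x) (x , i) ≡ (x′ , i) × shiftV (x′ - x) (y , j) ≡ (y′ , j)
translate-by-difference x y x′ y′ {i} {j} eq = cong (_, i) (i+[j-i]≡j x x′) , cong (_, j) y↦y′
  where
  y↦y′ : y + (x′ - x) ≡ y′
  y↦y′ = begin
    y + (x′ - x)    ≡⟨ i+[j-k]≡j+[i-k] y x′ x ⟩
    x′ + (y - x)    ≡⟨ cong (λ z → x′ + z) eq ⟩
    x′ + (y′ - x′)  ≡⟨ i+[j-i]≡j x′ y′ ⟩
    y′              ∎

sameLevel-translate : ∀ {x y x′ y′} i → x ≢ y → x′ ≢ y′ → ∣ y - x ∣ ∸ 1 ≡ ∣ y′ - x′ ∣ ∸ 1 →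
                      Translate (x , i) (y , i) (x′ , i) (y′ , i)
sameLevel-translate {x} {y} {x′} {y′} i x≢y x′≢y′ eq
  with ∣i∣∸1≡∣j∣∸1⇒i≡±j (x≢y ∘ sym ∘ ℤ.i-j≡0⇒i≡j y x) (x′≢y′ ∘ sym ∘ ℤ.i-j≡0⇒i≡j y′ x′) eq
... | inj₁ same     = _ , inj₁ (translate-by-difference x y x′ y′ same)
... | inj₂ opposed  = _ , inj₂ (translate-by-difference x y y′ x′ (trans opposed (⁻¹-anti-homo‿- y′ x′)))

orbit≡⇒Translate : ∀ u v u′ v′ → u ≢ v → u′ ≢ v′ → orbit u v ≡ orbit u′ v′ → Translate u v u′ v′
orbit≡⇒Translate (x , zero) (y , zero) (x′ , zero) (y′ , zero) u≢v u′≢v′ eq =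
  sameLevel-translate zero (u≢v ∘ cong (_, zero)) (u′≢v′ ∘ cong (_, zero))
                      (cong proj₂ (inj₁-injective eq))
orbit≡⇒Translate (x , suc zero) (y , suc zero) (x′ , suc zero) (y′ , suc zero) u≢v u′≢v′ eq =
  sameLevel-translate (suc zero) (u≢v ∘ cong (_, suc zero)) (u′≢v′ ∘ cong (_, suc zero))
                      (cong proj₂ (inj₁-injective eq))
orbit≡⇒Translate (x , zero) (y , suc zero) (x′ , zero) (y′ , suc zero) _ _ eq =
  _ , inj₁ (translate-by-difference x y x′ y′ (inj₂-injective eq))
orbit≡⇒Translate (x , zero) (y , suc zero) (x′ , suc zero) (y′ , zero) _ _ eq =
  _ , inj₂ (translate-by-difference x y y′ x′ (inj₂-injective eq))
orbit≡⇒Translate (x , suc zero) (y , zero) (x′ , suc zero) (y′ , zero) _ _ eq =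
  _ , inj₁ (swap (translate-by-difference y x y′ x′ (inj₂-injective eq)))
orbit≡⇒Translate (x , suc zero) (y , zero) (x′ , zero) (y′ , suc zero) _ _ eq =
  _ , inj₂ (swap (translate-by-difference y x x′ y′ (inj₂-injective eq)))
orbit≡⇒Translate (_ , zero)     (_ , zero)     (_ , zero)     (_ , suc zero) _ _ ()
orbit≡⇒Translate (_ , zero)     (_ , zero)     (_ , suc zero) (_ , zero)     _ _ ()
orbit≡⇒Translate (_ , zero)     (_ , zero)     (_ , suc zero) (_ , suc zero) _ _ ()
orbit≡⇒Translate (_ , suc zero) (_ , suc zero) (_ , zero)     (_ , zero)     _ _ ()
orbit≡⇒Translate (_ , suc zero) (_ , suc zero) (_ , zero)     (_ , suc zero) _ _ ()
orbit≡⇒Translate (_ , suc zero) (_ , suc zero) (_ , suc zero) (_ , zero)     _ _ ()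
orbit≡⇒Translate (_ , zero)     (_ , suc zero) (_ , zero)     (_ , zero)     _ _ ()
orbit≡⇒Translate (_ , zero)     (_ , suc zero) (_ , suc zero) (_ , suc zero) _ _ ()
orbit≡⇒Translate (_ , suc zero) (_ , zero)     (_ , zero)     (_ , zero)     _ _ ()
orbit≡⇒Translate (_ , suc zero) (_ , zero)     (_ , suc zero) (_ , suc zero) _ _ ()

-- Stars whose spokes represent every orbit once

KStarGraph-irreflexive : ∀ {k} p → ¬ KStarGraph k p p
KStarGraph-irreflexive _ (_ , inj₁ (m≡0 , m≢0)) = m≢0 m≡0
KStarGraph-irreflexive _ (_ , inj₂ (m≡0 , m≢0)) = m≢0 m≡0

KStarGraph⇒spoke : ∀ {k} {p q : Fin k × ℕ} → KStarGraph k p q →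
                   ∃₂ λ j n → SameEdge p q (j , 0) (j , suc n)
KStarGraph⇒spoke {q = _ , zero}  (refl , inj₁ (refl , n≢0)) = ⊥-elim (n≢0 refl)
KStarGraph⇒spoke {q = _ , suc n} (refl , inj₁ (refl , _))   = _ , n , inj₁ (refl , refl)
KStarGraph⇒spoke {p = _ , zero}  (refl , inj₂ (refl , m≢0)) = ⊥-elim (m≢0 refl)
KStarGraph⇒spoke {p = _ , suc m} (refl , inj₂ (refl , _))   = _ , m , inj₂ (refl , refl)

spoke⇒KStarGraph : ∀ {k} {p q : Fin k × ℕ} {j n} → SameEdge p q (j , 0) (j , suc n) →
                   KStarGraph k p q
spoke⇒KStarGraph (inj₁ (refl , refl)) = refl , inj₁ (refl , λ ())
spoke⇒KStarGraph (inj₂ (refl , refl)) = refl , inj₂ (refl , λ ())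

spokeOrbit : ∀ {k} → (Fin k × ℕ) ↔ V → Fin k × ℕ → Orbit
spokeOrbit vertex (j , n) = orbit (to (j , 0)) (to (j , suc n))
  where open Inverse vertex

record StarFactorisation (k : ℕ) : Set where
  field
    vertex      : (Fin k × ℕ) ↔ V
    spoke       : (Fin k × ℕ) ↔ Orbit
    spoke-orbit : ∀ p → Inverse.to spoke p ≡ spokeOrbit vertex p

module _ {k} (S : StarFactorisation k) where
  open StarFactorisation S
  private
    module Vertex = Inverse vertex
    module Spoke  = Inverse spoke

  centre : Fin k → V
  centre j = Vertex.to (j , 0)

  leaf : Fin k → ℕ → V
  leaf j n = Vertex.to (j , suc n)

  starGraph : Graph V
  starGraph u v = KStarGraph k (Vertex.from u) (Vertex.from v)

  starGraph-isKStar : IsKStar k starGraph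
  starGraph-isKStar = ↔⇒⤖ (↔-sym vertex) , λ _ _ → mk⇔ id id

  starGraph⇒spoke : ∀ {a b} → starGraph a b → ∃₂ λ j n → SameEdge a b (centre j) (leaf j n)
  starGraph⇒spoke {a} {b} e with KStarGraph⇒spoke e
  ... | j , n , s = j , n , subst₂ (λ a′ b′ → SameEdge a′ b′ _ _)
                              (Vertex.strictlyInverseˡ a) (Vertex.strictlyInverseˡ b)
                              (SameEdge-map Vertex.to s)

  spoke⇒starGraph : ∀ {a b j n} → SameEdge a b (centre j) (leaf j n) → starGraph a b
  spoke⇒starGraph {j = j} {n} s = spoke⇒KStarGraph
    (subst₂ (SameEdge _ _) (Vertex.strictlyInverseʳ (j , 0)) (Vertex.strictlyInverseʳ (j , suc n))
            (SameEdge-map Vertex.from s))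

  centre≢leaf : ∀ j n → centre j ≢ leaf j n
  centre≢leaf j n eq with Injection.injective (↔⇒↣ vertex) eq
  ... | ()

  spokeOrbit-injective : ∀ {p q} → spokeOrbit vertex p ≡ spokeOrbit vertex q → p ≡ q
  spokeOrbit-injective {p} {q} eq =
    Injection.injective (↔⇒↣ spoke) (trans (spoke-orbit p) (trans eq (sym (spoke-orbit q))))

  translates⊆K : ∀ d u v → (starGraph +G d) u v → KEdge u v
  translates⊆K d u v e refl = KStarGraph-irreflexive _ e

  translate-unique : ∀ u v {d e} → (starGraph +G d) u v → (starGraph +G e) u v → d ≡ e
  translate-unique u v {d} {e} Γd Γe with starGraph⇒spoke Γd | starGraph⇒spoke Γe
  ... | j , n , s | j′ , n′ , s′ with spokeOrbit-injective {j , n} {j′ , n′} (begin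
        orbit (centre j) (leaf j n)                ≡⟨ orbit-SameEdge s ⟨
        orbit (shiftV (- d) u) (shiftV (- d) v)    ≡⟨ orbit-shift (- d) u v ⟩
        orbit u v                                  ≡⟨ orbit-shift (- e) u v ⟨
        orbit (shiftV (- e) u) (shiftV (- e) v)    ≡⟨ orbit-SameEdge s′ ⟩
        orbit (centre j′) (leaf j′ n′)             ∎)
  ... | refl = ℤ.neg-injective (translation-unique {u = u} {v} s s′)

  translate-exists : ∀ u v → KEdge u v → ∃ λ d → (starGraph +G d) u v
  translate-exists u v u≢v with Spoke.from (orbit u v) | Spoke.strictlyInverseˡ (orbit u v)
  ... | j , n | spoke≡orbit
    with orbit≡⇒Translate u v (centre j) (leaf j n) u≢v (centre≢leaf j n)
           (trans (sym spoke≡orbit) (spoke-orbit (j , n)))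
  ... | d , s = - d , subst (λ t → starGraph (shiftV t u) (shiftV t v)) (sym (ℤ.neg-involutive d))
                            (spoke⇒starGraph s)

  edge-in-unique-translate : ∀ u v → KEdge u v → ∃! _≡_ (λ d → (starGraph +G d) u v)
  edge-in-unique-translate u v u≢v with translate-exists u v u≢v
  ... | d , Γd = d , Γd , translate-unique u v Γd

-- Splitting a periodic star

double : ℕ → ℕ
double zero    = zero
double (suc n) = suc (suc (double n))

halve : ℕ → ℕ ⊎ ℕ
halve zero          = inj₂ zero
halve (suc zero)    = inj₁ zero
halve (suc (suc n)) = map ℕ.suc ℕ.suc (halve n)

ℕ⊎ℕ↔ℕ : (ℕ ⊎ ℕ) ↔ ℕ
ℕ⊎ℕ↔ℕ = mk↔ₛ′ [ suc ∘ double , double ]′ halve to-halve halve-to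
  where
  to-halve : ∀ n → [ suc ∘ double , double ]′ (halve n) ≡ n
  to-halve zero          = refl
  to-halve (suc zero)    = refl
  to-halve (suc (suc n)) with halve n | to-halve n
  ... | inj₁ _ | eq = cong (2 ℕ.+_) eq
  ... | inj₂ _ | eq = cong (2 ℕ.+_) eq
  halve-to : ∀ s → halve ([ suc ∘ double , double ]′ s) ≡ s
  halve-to (inj₁ zero)    = refl
  halve-to (inj₁ (suc t)) = cong (map ℕ.suc ℕ.suc) (halve-to (inj₁ t))
  halve-to (inj₂ zero)    = refl
  halve-to (inj₂ (suc t)) = cong (map ℕ.suc ℕ.suc) (halve-to (inj₂ t))

module ℕ⊎ℕ = Inverse ℕ⊎ℕ↔ℕ

halve-odd : ∀ t → halve (suc (double t)) ≡ inj₁ t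
halve-odd t = ℕ⊎ℕ.strictlyInverseʳ (inj₁ t)

halve-even : ∀ t → halve (double t) ≡ inj₂ t
halve-even t = ℕ⊎ℕ.strictlyInverseʳ (inj₂ t)

splitIndex : (ℕ ⊎ ℕ) ↔ ℕ
splitIndex = mk↔ₛ′ to from to∘from from∘to
  where
  to : ℕ ⊎ ℕ → ℕ
  to (inj₁ n)       = double (suc n)
  to (inj₂ zero)    = zero
  to (inj₂ (suc m)) = suc (double m)
  from : ℕ → ℕ ⊎ ℕ
  from zero    = inj₂ zero
  from (suc n) = map₂ ℕ.suc (halve n)
  to∘from : ∀ n → to (from n) ≡ n
  to∘from zero = refl
  to∘from (suc n) with halve n | ℕ⊎ℕ.strictlyInverseˡ n
  ... | inj₁ _ | eq = cong ℕ.suc eq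
  ... | inj₂ _ | eq = cong ℕ.suc eq
  from∘to : ∀ s → from (to s) ≡ s
  from∘to (inj₁ n)       = cong (map₂ ℕ.suc) (halve-odd n)
  from∘to (inj₂ zero)    = refl
  from∘to (inj₂ (suc m)) = cong (map₂ ℕ.suc) (halve-even m)

mergeFirstTwo : ∀ {k} {A : Set} → (A ⊎ A) ↔ A → (Fin (2 ℕ.+ k) × A) ↔ (Fin (suc k) × A)
mergeFirstTwo {k} {A} ι = mk↔ₛ′ to from to∘from from∘to
  where
  module ι = Inverse ι
  to : Fin (2 ℕ.+ k) × A → Fin (suc k) × A
  to (zero , a)        = zero , ι.to (inj₁ a)
  to (suc zero , a)    = zero , ι.to (inj₂ a)
  to (suc (suc i) , a) = suc i , a
  fromFirst : A ⊎ A → Fin (2 ℕ.+ k) × A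
  fromFirst = [ (zero ,_) , (suc zero ,_) ]′
  from : Fin (suc k) × A → Fin (2 ℕ.+ k) × A
  from (zero , a)  = fromFirst (ι.from a)
  from (suc i , a) = suc (suc i) , a
  to∘from : ∀ p → to (from p) ≡ p
  to∘from (zero , a) with ι.from a | ι.strictlyInverseˡ a
  ... | inj₁ _ | eq = cong (zero ,_) eq
  ... | inj₂ _ | eq = cong (zero ,_) eq
  to∘from (suc i , a) = refl
  from∘to : ∀ p → from (to p) ≡ p
  from∘to (zero , a)        = cong fromFirst (ι.strictlyInverseʳ (inj₁ a))
  from∘to (suc zero , a)    = cong fromFirst (ι.strictlyInverseʳ (inj₂ a))
  from∘to (suc (suc i) , a) = refl

reindex : ∀ {k k′} (S : StarFactorisation k) (σ τ : (Fin k′ × ℕ) ↔ (Fin k × ℕ)) →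
          (let vertex = StarFactorisation.vertex S in
           ∀ p → spokeOrbit (vertex ↔-∘ σ) p ≡ spokeOrbit vertex (Inverse.to τ p)) →
          StarFactorisation k′
reindex S σ τ eq = record
  { vertex      = vertex ↔-∘ σ
  ; spoke       = spoke ↔-∘ τ
  ; spoke-orbit = λ p → trans (spoke-orbit (Inverse.to τ p)) (sym (eq p))
  }
  where open StarFactorisation S

Periodic : ∀ {k} → StarFactorisation (suc k) → Set
Periodic S = ∃ λ δ → ∀ n → Inverse.to vertex (zero , 2 ℕ.+ n) ≡ shiftV δ (Inverse.to vertex (zero , n))
  where open StarFactorisation S

split : ∀ {k} (S : StarFactorisation (suc k)) → Periodic S →
        Σ (StarFactorisation (2 ℕ.+ k)) Periodic
split {k} S (δ , periodic) = reindex S σ τ spokes , δ + δ , periodic′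
  where
  open StarFactorisation S
  v : Fin (suc k) × ℕ → V
  v = Inverse.to vertex
  -- σ: the new star 0 has vertices v (0 , 2n + 2), the new star 1 has centre v (0 , 0) and leaves
  -- v (0 , 2m + 1); τ gives them the old spokes of star 0 with odd and even index respectively.
  σ τ : (Fin (2 ℕ.+ k) × ℕ) ↔ (Fin (suc k) × ℕ)
  σ = mergeFirstTwo splitIndex
  τ = mergeFirstTwo ℕ⊎ℕ↔ℕ
  spokes : ∀ p → spokeOrbit (vertex ↔-∘ σ) p ≡ spokeOrbit vertex (Inverse.to τ p)
  spokes (zero , n) = begin
    orbit (v (zero , 2)) (v (zero , 2 ℕ.+ double (suc n)))
      ≡⟨ cong₂ orbit (periodic 0) (periodic (double (suc n))) ⟩
    orbit (shiftV δ (v (zero , 0))) (shiftV δ (v (zero , double (suc n))))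
      ≡⟨ orbit-shift δ _ _ ⟩
    orbit (v (zero , 0)) (v (zero , double (suc n)))
      ∎
  spokes (suc zero , n)    = refl
  spokes (suc (suc i) , n) = refl
  periodic′ : ∀ n → v (zero , double (suc (2 ℕ.+ n))) ≡ shiftV (δ + δ) (v (zero , double (suc n)))
  periodic′ n = begin
    v (zero , 2 ℕ.+ (2 ℕ.+ double (suc n)))           ≡⟨ periodic (2 ℕ.+ double (suc n)) ⟩
    shiftV δ (v (zero , 2 ℕ.+ double (suc n)))        ≡⟨ cong (shiftV δ) (periodic (double (suc n))) ⟩
    shiftV δ (shiftV δ (v (zero , double (suc n))))   ≡⟨ shiftV-∘ δ δ (v (zero , double (suc n))) ⟩
    shiftV (δ + δ) (v (zero , double (suc n)))        ∎

-- Star 0 has centre (−2, 0) and consists of the vertices (x , x mod 2) with x ≤ −2; star 1 has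
-- centre (−1, 1) and leaves (x , (x + 1) mod 2) with x ≤ −1; stars 2 and 3 have centres (0, 0)
-- and (0, 1) and as leaves all vertices (x , i) with x > 0 odd, respectively even.
module FourStars where

  levelOf : ℕ ⊎ ℕ → Fin 2
  levelOf (inj₁ _) = suc zero
  levelOf (inj₂ _) = zero

  parity : ℕ → Fin 2
  parity n = levelOf (halve n)

  parity-+2 : ∀ n → parity (2 ℕ.+ n) ≡ parity n
  parity-+2 n with halve n
  ... | inj₁ _ = refl
  ... | inj₂ _ = refl

  atLevel : (ℕ → ℤ) → ℕ ⊎ ℕ → V
  atLevel f (inj₁ t) = f t , suc zero
  atLevel f (inj₂ t) = f t , zero

  _*2+_ : ℕ → Fin 2 → ℕ
  t *2+ zero     = double t
  t *2+ suc zero = suc (double t)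

  atLevel-*2+ : ∀ f t i → atLevel f (halve (t *2+ i)) ≡ (f t , i)
  atLevel-*2+ f t zero       rewrite halve-even t = refl
  atLevel-*2+ f t (suc zero) rewrite halve-odd t  = refl

  vertexOf : Fin 4 × ℕ → V
  vertexOf (zero , p)                     = -[1+ suc p ] , opposite (parity (suc p))
  vertexOf (suc zero , zero)              = -[1+ 0 ] , suc zero
  vertexOf (suc zero , suc n)             = -[1+ n ] , parity n
  vertexOf (suc (suc zero) , zero)        = + 0 , zero
  vertexOf (suc (suc zero) , suc n)       = atLevel (λ t → + suc (double t)) (halve n)
  vertexOf (suc (suc (suc zero)) , zero)  = + 0 , suc zero
  vertexOf (suc (suc (suc zero)) , suc n) = atLevel (λ t → + double (suc t)) (halve n)

  negativeLabel : ℕ → Fin 2 → Fin 2 → Fin 4 × ℕ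
  negativeLabel p zero       zero       = # 1 , 2 ℕ.+ p
  negativeLabel p (suc zero) (suc zero) = # 1 , 2 ℕ.+ p
  negativeLabel p zero       (suc zero) = # 0 , p
  negativeLabel p (suc zero) zero       = # 0 , p

  labelOf : V → Fin 4 × ℕ
  labelOf (+ zero , zero)          = # 2 , 0
  labelOf (+ zero , suc zero)      = # 3 , 0
  labelOf (+ suc m , i)            =
    [ (λ t → # 3 , suc (t *2+ i)) , (λ t → # 2 , suc (t *2+ i)) ]′ (halve m)
  labelOf (-[1+ zero ] , zero)     = # 1 , 1
  labelOf (-[1+ zero ] , suc zero) = # 1 , 0
  labelOf (-[1+ suc p ] , i)       = negativeLabel p i (parity (suc p))

  labelOf-vertexOf : ∀ p → labelOf (vertexOf p) ≡ p
  labelOf-vertexOf (zero , p) with parity (suc p)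
  ... | zero     = refl
  ... | suc zero = refl
  labelOf-vertexOf (suc zero , zero)        = refl
  labelOf-vertexOf (suc zero , suc zero)    = refl
  labelOf-vertexOf (suc zero , suc (suc p)) with parity (suc p)
  ... | zero     = refl
  ... | suc zero = refl
  labelOf-vertexOf (suc (suc zero) , zero) = refl
  labelOf-vertexOf (suc (suc zero) , suc n) with halve n | ℕ⊎ℕ.strictlyInverseˡ n
  ... | inj₁ t | refl rewrite halve-even t = refl
  ... | inj₂ t | refl rewrite halve-even t = refl
  labelOf-vertexOf (suc (suc (suc zero)) , zero) = refl
  labelOf-vertexOf (suc (suc (suc zero)) , suc n) with halve n | ℕ⊎ℕ.strictlyInverseˡ n
  ... | inj₁ t | refl rewrite halve-odd t = refl
  ... | inj₂ t | refl rewrite halve-odd t = refl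

  vertexOf-labelOf : ∀ v → vertexOf (labelOf v) ≡ v
  vertexOf-labelOf (+ zero , zero)     = refl
  vertexOf-labelOf (+ zero , suc zero) = refl
  vertexOf-labelOf (+ suc m , i) with halve m | ℕ⊎ℕ.strictlyInverseˡ m
  ... | inj₁ t | refl = atLevel-*2+ _ t i
  ... | inj₂ t | refl = atLevel-*2+ _ t i
  vertexOf-labelOf (-[1+ zero ] , zero)     = refl
  vertexOf-labelOf (-[1+ zero ] , suc zero) = refl
  vertexOf-labelOf (-[1+ suc p ] , i) with parity (suc p) in eq | i
  ... | zero     | zero     rewrite eq = refl
  ... | zero     | suc zero rewrite eq = refl
  ... | suc zero | zero     rewrite eq = refl
  ... | suc zero | suc zero rewrite eq = refl

  vertex : (Fin 4 × ℕ) ↔ V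
  vertex = mk↔ₛ′ vertexOf labelOf vertexOf-labelOf labelOf-vertexOf

  spokeTable : Fin 4 → ℕ ⊎ ℕ → Orbit
  spokeTable zero                   (inj₁ t) = inj₁ (zero , suc (double t))
  spokeTable zero                   (inj₂ t) = inj₂ -[1+ double t ]
  spokeTable (suc zero)             (inj₁ t) = inj₁ (suc zero , double t)
  spokeTable (suc zero)             (inj₂ t) = inj₂ (+ double t)
  spokeTable (suc (suc zero))       (inj₁ t) = inj₂ (+ suc (double t))
  spokeTable (suc (suc zero))       (inj₂ t) = inj₁ (zero , double t)
  spokeTable (suc (suc (suc zero))) (inj₁ t) = inj₁ (suc zero , suc (double t))
  spokeTable (suc (suc (suc zero))) (inj₂ t) = inj₂ -[1+ suc (double t) ]

  spokeOrbit≡spokeTable : ∀ j s → spokeOrbit vertex (j , ℕ⊎ℕ.to s) ≡ spokeTable j s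
  spokeOrbit≡spokeTable zero (inj₁ t) rewrite parity-+2 (suc (double t)) | halve-odd t = refl
  spokeOrbit≡spokeTable zero (inj₂ t) rewrite parity-+2 (double t) | halve-even t = refl
  spokeOrbit≡spokeTable (suc zero) (inj₁ t) rewrite halve-odd t = refl
  spokeOrbit≡spokeTable (suc zero) (inj₂ t) rewrite halve-even t = refl
  spokeOrbit≡spokeTable (suc (suc zero)) (inj₁ t)
    rewrite halve-odd t | ℕₚ.+-identityʳ (double t) = refl
  spokeOrbit≡spokeTable (suc (suc zero)) (inj₂ t)
    rewrite halve-even t | ℕₚ.+-identityʳ (double t) = refl
  spokeOrbit≡spokeTable (suc (suc (suc zero))) (inj₁ t)
    rewrite halve-odd t | ℕₚ.+-identityʳ (double t) = refl
  spokeOrbit≡spokeTable (suc (suc (suc zero))) (inj₂ t) rewrite halve-even t = refl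

  spokeOf : Orbit → Fin 4 × ℕ
  spokeOf (inj₁ (zero , m))     = [ (λ _ → # 0 , m) , (λ _ → # 2 , m) ]′ (halve m)
  spokeOf (inj₁ (suc zero , m)) = [ (λ _ → # 3 , m) , (λ _ → # 1 , suc m) ]′ (halve m)
  spokeOf (inj₂ (+ m))          = [ (λ _ → # 2 , m) , (λ _ → # 1 , m) ]′ (halve m)
  spokeOf (inj₂ -[1+ m ])       = [ (λ t → # 3 , double t) , (λ _ → # 0 , m) ]′ (halve m)

  spokeOf-spokeTable : ∀ j s → spokeOf (spokeTable j s) ≡ (j , ℕ⊎ℕ.to s)
  spokeOf-spokeTable zero                   (inj₁ t) rewrite halve-odd t  = refl
  spokeOf-spokeTable zero                   (inj₂ t) rewrite halve-even t = refl
  spokeOf-spokeTable (suc zero)             (inj₁ t) rewrite halve-even t = refl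
  spokeOf-spokeTable (suc zero)             (inj₂ t) rewrite halve-even t = refl
  spokeOf-spokeTable (suc (suc zero))       (inj₁ t) rewrite halve-odd t  = refl
  spokeOf-spokeTable (suc (suc zero))       (inj₂ t) rewrite halve-even t = refl
  spokeOf-spokeTable (suc (suc (suc zero))) (inj₁ t) rewrite halve-odd t  = refl
  spokeOf-spokeTable (suc (suc (suc zero))) (inj₂ t) rewrite halve-odd t  = refl

  spokeOf-spokeOrbit : ∀ p → spokeOf (spokeOrbit vertex p) ≡ p
  spokeOf-spokeOrbit (j , n) with halve n | ℕ⊎ℕ.strictlyInverseˡ n
  ... | s | refl = trans (cong spokeOf (spokeOrbit≡spokeTable j s)) (spokeOf-spokeTable j s)

  spokeOrbit-spokeOf : ∀ o → spokeOrbit vertex (spokeOf o) ≡ o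
  spokeOrbit-spokeOf (inj₁ (zero , m)) with halve m | ℕ⊎ℕ.strictlyInverseˡ m
  ... | inj₁ t | refl = spokeOrbit≡spokeTable (# 0) (inj₁ t)
  ... | inj₂ t | refl = spokeOrbit≡spokeTable (# 2) (inj₂ t)
  spokeOrbit-spokeOf (inj₁ (suc zero , m)) with halve m | ℕ⊎ℕ.strictlyInverseˡ m
  ... | inj₁ t | refl = spokeOrbit≡spokeTable (# 3) (inj₁ t)
  ... | inj₂ t | refl = spokeOrbit≡spokeTable (# 1) (inj₁ t)
  spokeOrbit-spokeOf (inj₂ (+ m)) with halve m | ℕ⊎ℕ.strictlyInverseˡ m
  ... | inj₁ t | refl = spokeOrbit≡spokeTable (# 2) (inj₁ t)
  ... | inj₂ t | refl = spokeOrbit≡spokeTable (# 1) (inj₂ t)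
  spokeOrbit-spokeOf (inj₂ -[1+ m ]) with halve m | ℕ⊎ℕ.strictlyInverseˡ m
  ... | inj₁ t | refl = spokeOrbit≡spokeTable (# 3) (inj₂ t)
  ... | inj₂ t | refl = spokeOrbit≡spokeTable (# 0) (inj₂ t)

  starFactorisation : StarFactorisation 4
  starFactorisation = record
    { vertex      = vertex
    ; spoke       = mk↔ₛ′ (spokeOrbit vertex) spokeOf spokeOrbit-spokeOf spokeOf-spokeOrbit
    ; spoke-orbit = λ _ → refl
    }

  periodic : Periodic starFactorisation
  periodic = -[1+ 1 ] , λ p →
    cong₂ _,_ (cong (λ m → -[1+ 2 ℕ.+ m ]) (sym (ℕₚ.+-comm p 1))) (cong opposite (parity-+2 (suc p)))

factorisations : ∀ r → Σ (StarFactorisation (4 ℕ.+ r)) Periodic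
factorisations zero    = FourStars.starFactorisation , FourStars.periodic
factorisations (suc r) = uncurry split (factorisations r)

proposition4p5 : (k : ℕ) → 4 ≤ k →
    Σ (Graph V) λ Γ →
      IsKStar k Γ
      × (∀ (d : ℤ) u v → (Γ +G d) u v → KEdge u v)
      × (∀ u v → KEdge u v → ∃! _≡_ (λ (d : ℤ) → (Γ +G d) u v))
proposition4p5 (suc (suc (suc (suc r)))) (s≤s (s≤s (s≤s (s≤s z≤n)))) =
  starGraph S , starGraph-isKStar S , translates⊆K S , edge-in-unique-translate S
  where
  S : StarFactorisation (4 ℕ.+ r)
  S = proj₁ (factorisations r)
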